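{- Let $n$ be a positive integer, let $D$ be a convex digraph of order $n$, and let $T$ be an antidirected caterpillar (with a fixed spine and final vertex). Then $D$ contains at least $a(D)-(|T^+|-1)|D^-|-(|T^-|-1)|D^+|$ arcs that are good for $T$.
   Context: A digraph is finite, without loops or parallel arcs, but may contain both $xy$ and $yx$; $a(D)$ is its number of arcs; $D^+$ ($D^-$) is the set of vertices of positive out-degree (in-degree), similarly $T^+,T^-$. A convex digraph is a digraph drawn in the plane with its vertices on the unit circle and arcs as straight segments. For vertices $x,y$, $V^{x,y}_{\leftarrow x}$ is the set of vertices lying strictly after $x$ and before $y$ going clockwise, and $V^{x,y}_{x\rightarrow}=V(D)\setminus(\{x,y\}\cup V^{x,y}_{\leftarrow x})$. A caterpillar is a tree viewed as a path $P$ (the spine), whose endpoints are leaves of the tree, plus leaves attached to inner vertices of $P$; one endpoint $u$ of $P$ is the final vertex and $v$ denotes its neighbour. An antidirected caterpillar is an orientation with no directed path of length two. An arc $a$ of $D$ is good for $T$ if there is an embedding $f$ of $T$ in $D$ (injective, arcs to arcs) such that, with $x=f(u)$, $y=f(v)$: the arc of $T$ between $u$ and $v$ is mapped to $a$; if $|V(P)|$ is odd then $V^{x,y}_{\leftarrow x}$ contains no image of a vertex of $T$; if $|V(P)|$ is even then $V^{x,y}_{x\rightarrow}$ contains no image of a vertex of $T$. -}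

module Defs where

open import Data.Bool using (Bool; true; false; if_then_else_)
open import Data.Nat using (ℕ; zero; suc; _+_; _*_; _<_; _≤_; _%_)
open import Data.Fin using (Fin; toℕ)
open import Data.List using (List; map; allFin)
open import Data.Nat.ListAction using (sum)
open import Data.Bool.ListAction using (any)
open import Data.Product using (Σ; ∃; ∃-syntax; _×_; _,_)
open import Data.Sum using (_⊎_)
open import Relation.Binary.PropositionalEquality using (_≡_; _≢_)
open import Relation.Nullary using (¬_)
open import Function.Bundles using (_⇔_)

record Digraph (n : ℕ) : Set where
  field
    arc      : Fin n → Fin n → Bool
    loopless : ∀ x → arc x x ≡ false
open Digraph public

countFin : ∀ {n} → (Fin n → Bool) → ℕ
countFin {n} p = sum (map (λ i → if p i then 1 else 0) (allFin n))

countPairs : ∀ {n} → (Fin n → Fin n → Bool) → ℕ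
countPairs {n} r = sum (map (λ x → countFin (r x)) (allFin n))

a : ∀ {n} → Digraph n → ℕ
a D = countPairs (arc D)

-- |D⁺| : number of vertices of positive out-degree
outPos : ∀ {n} → Digraph n → ℕ
outPos {n} D = countFin (λ x → any (λ y → arc D x y) (allFin n))

-- |D⁻| : number of vertices of positive in-degree
inPos : ∀ {n} → Digraph n → ℕ
inPos {n} D = countFin (λ y → any (λ x → arc D x y) (allFin n))

-- A convex digraph of order n is represented by a
-- digraph on Fin n where vertex i is the i-th vertex met when going
-- clockwise around the unit circle (any convex drawing can be labelled
-- this way).  Only the cyclic order of the vertices matters.

-- cwBetween x y z : z lies strictly after x and strictly before y when
-- going clockwise (z ∈ V^{x,y}_{←x}).
cwBetween : ∀ {n} → Fin n → Fin n → Fin n → Set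
cwBetween x y z =
  (toℕ x < toℕ y × toℕ x < toℕ z × toℕ z < toℕ y)
  ⊎ (toℕ y < toℕ x × (toℕ x < toℕ z ⊎ toℕ z < toℕ y))

cwOutside : ∀ {n} → Fin n → Fin n → Fin n → Set
cwOutside x y z = z ≢ x × z ≢ y × ¬ cwBetween x y z

-- The spine P = p₀ p₁ … p_{k-1} (k = 2 + len ≥ 2 vertices, injective),
-- p₀ = u is the final vertex, p₁ = v its neighbour.  Every vertex not
-- on the spine is a leaf attached to an inner spine vertex p_i
-- (1 ≤ i ≤ k-2).

record AntidirectedCaterpillar {m : ℕ} (T : Digraph m) : Set where
  field
    len    : ℕ
    spine  : Fin (suc (suc len)) → Fin m
    spine-injective : ∀ i j → spine i ≡ spine j → i ≡ j
    attach : Fin m → Fin (suc (suc len))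
    attach-inner : ∀ w → (∀ i → spine i ≢ w) →
                   1 ≤ toℕ (attach w) × suc (toℕ (attach w)) < suc (suc len)

  SpineEdge : Fin m → Fin m → Set
  SpineEdge x y = ∃[ i ] ∃[ j ] (toℕ j ≡ suc (toℕ i) ×
                   ((x ≡ spine i × y ≡ spine j) ⊎ (x ≡ spine j × y ≡ spine i)))

  LeafEdge : Fin m → Fin m → Set
  LeafEdge x y = ((∀ i → spine i ≢ x) × y ≡ spine (attach x))
               ⊎ ((∀ i → spine i ≢ y) × x ≡ spine (attach y))

  field
    edges        : ∀ x y → (arc T x y ≡ true ⊎ arc T y x ≡ true) ⇔ (SpineEdge x y ⊎ LeafEdge x y)
    oriented     : ∀ x y → arc T x y ≡ true → arc T y x ≡ false
    antidirected : ∀ x y z → arc T x y ≡ true → arc T y z ≡ false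

  spineSize : ℕ
  spineSize = suc (suc len)

  u : Fin m
  u = spine Data.Fin.zero
  v : Fin m
  v = spine (Data.Fin.suc Data.Fin.zero)
open AntidirectedCaterpillar public

record Embedding {m n : ℕ} (T : Digraph m) (D : Digraph n) : Set where
  field
    fun       : Fin m → Fin n
    injective : ∀ a b → fun a ≡ fun b → a ≡ b
    arcs      : ∀ a b → arc T a b ≡ true → arc D (fun a) (fun b) ≡ true
open Embedding public

Good : ∀ {m n} (D : Digraph n) (T : Digraph m) → AntidirectedCaterpillar T →
       Fin n → Fin n → Set
Good D T C s t = Σ (Embedding T D) λ f →
  let x = fun f (u C) ; y = fun f (v C) in
  ((arc T (u C) (v C) ≡ true × s ≡ x × t ≡ y)
    ⊎ (arc T (v C) (u C) ≡ true × s ≡ y × t ≡ x))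
  × (spineSize C % 2 ≡ 1 → ∀ w → ¬ cwBetween x y (fun f w))
  × (spineSize C % 2 ≡ 0 → ∀ w → ¬ cwOutside x y (fun f w))

{-# OPTIONS --safe #-}
module Submission where

-- Peel the caterpillar off from the far end of its spine p₀ p₁ … p_{L+1}.  For c = L, …, 0
-- keep a set of pairs (x , y) such that the tail of T beyond p_c embeds with p_c ↦ x and
-- p_{c+1} ↦ y, every image lying on the side of the chord xy that the parity of the remaining
-- spine requires, and such that  a(D) + |D⁺| + |D⁻| ≤ #pairs + w(tail), where a vertex of T
-- weighs |D⁺| if it has an in-arc and |D⁻| if it has an out-arc.
--
-- To go from c + 1 to c, fix an image y of p_{c+1} and measure distances from y round the
-- circle in the direction given by the parity.  Keep the farthest partner z of y: the tail
-- embedded for (y , z) avoids the open arc from y to z.  Place the leaves of p_{c+1} one by one,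
-- each at the farthest neighbour of y inside the current arc, which then shrinks to end there;
-- finally pair every neighbour x left inside with y.  Each choice loses at most one pair for
-- each y having a neighbour of the right kind, i.e. at most |D⁺| or |D⁻| pairs, and the vertex
-- placed next weighs at least that much.  At c = 0 the weight of T is |T⁻||D⁺| + |T⁺||D⁻|.

open import Defs

module Lemmas where

  open import Data.Bool using (Bool; true; false; if_then_else_)
  open import Data.Bool.Properties using (T-≡) renaming (_≟_ to _≟ᵇ_)
  open import Data.Bool.ListAction using (any)
  open import Data.Fin using (Fin; zero; suc; toℕ; fromℕ<)
  open import Data.Fin.Properties using (_≟_; toℕ-injective; toℕ<n; toℕ-fromℕ<; all?; any?)
  open import Data.List as List using (allFin; tabulate)
  open import Data.List.Properties using (map-tabulate)
  open import Data.List.Membership.Propositional using (lose)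
  open import Data.List.Membership.Propositional.Properties using (∈-allFin)
  open import Data.List.Relation.Unary.Any using (satisfied)
  open import Data.List.Relation.Unary.Any.Properties using (any⁺; any⁻)
  open import Data.Nat using (ℕ; zero; suc; pred; _+_; _*_; _∸_; _≤_; _<_; _%_; parity; z≤n; s≤s; s≤s⁻¹; _≤?_; _<?_)
  open import Data.Nat.ListAction using () renaming (sum to sumᴸ)
  open import Data.Nat.Properties hiding (_≟_)
  import Data.Nat.Properties as ℕ
  open import Data.Parity using (Parity; 0ℙ; 1ℙ; _⁻¹)
  open import Data.Parity.Properties using (⁻¹-selfInverse; suc-homo-⁻¹)
  open import Data.Product using (Σ; ∃-syntax; _×_; _,_; proj₁; proj₂)
  open import Data.Sum as Sum using (_⊎_; inj₁; inj₂)
  open import Data.Vec.Functional using (updateAt)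
  open import Data.Vec.Functional.Properties using (updateAt-updates; updateAt-minimal)
  open import Function using (id; const; _∘_)
  open import Function.Bundles using (Equivalence)
  open import Level using (0ℓ)
  open import Relation.Binary.Definitions using (tri<; tri≈; tri>)
  open import Relation.Binary.PropositionalEquality
  open import Relation.Nullary using (Dec; yes; no; does; ¬_; ¬?; contradiction)
  open import Relation.Nullary.Decidable using (_×-dec_; _⊎-dec_)
  open import Relation.Unary using (Pred; Decidable; _⊆_; _∪_; ｛_｝; ∅)
  open import Algebra.Properties.Semiring.Sum +-*-semiring
    using (sum; ∑-distrib-+; ∑-comm; sum-cong-≗; sum-replicate-zero; *-distribʳ-sum)

  private
    variable
      k : ℕ

  sum-mono-≤ : {f g : Fin k → ℕ} → (∀ i → f i ≤ g i) → sum f ≤ sum g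
  sum-mono-≤ {zero}  f≤g = z≤n
  sum-mono-≤ {suc k} f≤g = +-mono-≤ (f≤g zero) (sum-mono-≤ (f≤g ∘ suc))

  sum-zero : {f : Fin k → ℕ} → (∀ i → f i ≡ 0) → sum f ≡ 0
  sum-zero {k} f≡0 = trans (sum-cong-≗ f≡0) (sum-replicate-zero k)

  from-does : ∀ {P : Set} (P? : Dec P) → does P? ≡ true → P
  from-does (yes p) _ = p

  sumOver : {P : Pred (Fin k) 0ℓ} → Decidable P → (Fin k → ℕ) → ℕ
  sumOver P? f = sum λ i → if does (P? i) then f i else 0

  count : {P : Pred (Fin k) 0ℓ} → Decidable P → ℕ
  count P? = sumOver P? (const 1)

  module _ {P Q : Pred (Fin k) 0ℓ} (P? : Decidable P) (Q? : Decidable Q) (f : Fin k → ℕ) where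

    sumOver-mono : P ⊆ Q → sumOver P? f ≤ sumOver Q? f
    sumOver-mono P⊆Q = sum-mono-≤ pointwise
      where
      pointwise : ∀ i → (if does (P? i) then f i else 0) ≤ (if does (Q? i) then f i else 0)
      pointwise i with P? i | Q? i
      ... | no _   | _      = z≤n
      ... | yes _  | yes _  = ≤-refl
      ... | yes Pi | no ¬Qi = contradiction (P⊆Q Pi) ¬Qi

  sumOver-singleton : (v : Fin k) (f : Fin k → ℕ) → sumOver (v ≟_) f ≡ f v
  sumOver-singleton {suc k} zero f = trans (cong (f zero +_) (sum-zero {k} λ i → refl)) (+-identityʳ (f zero))
  sumOver-singleton {suc k} (suc v) f = sumOver-singleton v (f ∘ suc)

  module _ {P Q : Pred (Fin k) 0ℓ} (P? : Decidable P) (Q? : Decidable Q) (f : Fin k → ℕ) (v : Fin k) where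

    private
      onP onQ onV : Fin k → ℕ
      onP i = if does (P? i) then f i else 0
      onQ i = if does (Q? i) then f i else 0
      onV i = if does (v ≟ i) then f i else 0

    sumOver-insert : P ⊆ Q → Q v → ¬ P v → sumOver P? f + f v ≤ sumOver Q? f
    sumOver-insert P⊆Q Qv ¬Pv = begin
      sumOver P? f + f v                ≡⟨ cong (sumOver P? f +_) (sumOver-singleton v f) ⟨
      sum onP + sum onV                 ≡⟨ ∑-distrib-+ onP onV ⟨
      sum (λ i → onP i + onV i)         ≤⟨ sum-mono-≤ pointwise ⟩
      sumOver Q? f                      ∎
      where
      open ≤-Reasoning
      pointwise : ∀ i → onP i + onV i ≤ onQ i
      pointwise i with v ≟ i | P? i | Q? i
      ... | yes refl | yes Pv  | _      = contradiction Pv ¬Pv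
      ... | yes refl | no _    | yes _  = ≤-refl
      ... | yes refl | no _    | no ¬Qv = contradiction Qv ¬Qv
      ... | no _     | no _    | _      = z≤n
      ... | no _     | yes _   | yes _  = ≤-reflexive (+-identityʳ (f i))
      ... | no _     | yes Pi  | no ¬Qi = contradiction (P⊆Q Pi) ¬Qi

    sumOver-⊆-insert : P ⊆ Q ∪ ｛ v ｝ → sumOver P? f ≤ sumOver Q? f + f v
    sumOver-⊆-insert P⊆Q∪v = begin
      sumOver P? f                      ≤⟨ sum-mono-≤ pointwise ⟩
      sum (λ i → onQ i + onV i)         ≡⟨ ∑-distrib-+ onQ onV ⟩
      sum onQ + sum onV                 ≡⟨ cong (sumOver Q? f +_) (sumOver-singleton v f) ⟩
      sumOver Q? f + f v                ∎
      where
      open ≤-Reasoning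
      pointwise : ∀ i → onP i ≤ onQ i + onV i
      pointwise i with P? i | Q? i | v ≟ i
      ... | no _   | _      | _      = z≤n
      ... | yes _  | yes _  | _      = m≤m+n (f i) _
      ... | yes _  | no _   | yes _  = ≤-refl
      ... | yes Pi | no ¬Qi | no v≢i with P⊆Q∪v Pi
      ...   | inj₁ Qi  = contradiction Qi ¬Qi
      ...   | inj₂ v≡i = contradiction v≡i v≢i

  count-∅ : {P : Pred (Fin k) 0ℓ} (P? : Decidable P) → (∀ i → ¬ P i) → count P? ≡ 0
  count-∅ P? ∅ = sum-zero pointwise
    where
    pointwise : ∀ i → (if does (P? i) then 1 else 0) ≡ 0
    pointwise i with P? i
    ... | yes Pi = contradiction Pi (∅ i)
    ... | no _   = refl

  farthest : {P : Pred (Fin k) 0ℓ} → Decidable P → (K : Fin k → ℕ) →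
             (∀ i → ¬ P i) ⊎ ∃[ z ] P z × (∀ i → P i → K i ≤ K z)
  farthest {zero} P? K = inj₁ λ ()
  farthest {suc k} P? K with farthest (P? ∘ suc) (K ∘ suc) | P? zero
  ... | inj₁ none | no ¬P0 = inj₁ λ { zero → ¬P0 ; (suc i) → none i }
  ... | inj₁ none | yes P0 = inj₂ (zero , P0 , λ { zero _ → ≤-refl ; (suc i) Pi → contradiction Pi (none i) })
  ... | inj₂ (z , Pz , max) | no ¬P0 = inj₂ (suc z , Pz , λ { zero P0 → contradiction P0 ¬P0 ; (suc i) → max i })
  ... | inj₂ (z , Pz , max) | yes P0 with K (suc z) ≤? K zero
  ...   | yes Kz≤K0 = inj₂ (zero , P0 , λ { zero _ → ≤-refl ; (suc i) Pi → ≤-trans (max i Pi) Kz≤K0 })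
  ...   | no Kz≰K0 = inj₂ (suc z , Pz , λ { zero _ → <⇒≤ (≰⇒> Kz≰K0) ; (suc i) → max i })

  listSum-allFin : (f : Fin k → ℕ) → sumᴸ (List.map f (allFin k)) ≡ sum f
  listSum-allFin {k} f = trans (cong sumᴸ (map-tabulate id f)) (listSum-tabulate f)
    where
    listSum-tabulate : ∀ {k} (f : Fin k → ℕ) → sumᴸ (tabulate f) ≡ sum f
    listSum-tabulate {zero}  f = refl
    listSum-tabulate {suc k} f = cong (f zero +_) (listSum-tabulate (f ∘ suc))

  countFin≡sum : (p : Fin k → Bool) → countFin p ≡ sum (λ i → if p i then 1 else 0)
  countFin≡sum p = listSum-allFin (λ i → if p i then 1 else 0)

  sum-if : (p : Fin k → Bool) (K : ℕ) → sum (λ i → if p i then K else 0) ≡ countFin p * K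
  sum-if p K = begin
    sum (λ i → if p i then K else 0)          ≡⟨ sum-cong-≗ pointwise ⟩
    sum (λ i → (if p i then 1 else 0) * K)    ≡⟨ *-distribʳ-sum K (λ i → if p i then 1 else 0) ⟨
    sum (λ i → if p i then 1 else 0) * K      ≡⟨ cong (_* K) (countFin≡sum p) ⟨
    countFin p * K                            ∎
    where
    open ≡-Reasoning
    pointwise : ∀ i → (if p i then K else 0) ≡ (if p i then 1 else 0) * K
    pointwise i with p i
    ... | true  = sym (+-identityʳ K)
    ... | false = refl

  countFin≡count : (p : Fin k → Bool) → countFin p ≡ count (λ i → p i ≟ᵇ true)
  countFin≡count p = trans (countFin≡sum p) (sum-cong-≗ pointwise)
    where
    pointwise : ∀ i → (if p i then 1 else 0) ≡ (if does (p i ≟ᵇ true) then 1 else 0)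
    pointwise i with p i
    ... | true  = refl
    ... | false = refl

  countPairs≡sum : (r : Fin k → Fin k → Bool) → countPairs r ≡ sum (λ i → countFin (r i))
  countPairs≡sum r = listSum-allFin (λ i → countFin (r i))

  countPairs-flip : (r : Fin k → Fin k → Bool) → countPairs (λ i j → r j i) ≡ countPairs r
  countPairs-flip r = begin
    countPairs (λ i j → r j i)                             ≡⟨ countPairs≡sum (λ i j → r j i) ⟩
    sum (λ i → countFin (λ j → r j i))                     ≡⟨ sum-cong-≗ (λ i → countFin≡sum (λ j → r j i)) ⟩
    sum (λ i → sum (λ j → if r j i then 1 else 0))         ≡⟨ ∑-comm (λ j i → if r j i then 1 else 0) ⟨
    sum (λ j → sum (λ i → if r j i then 1 else 0))         ≡⟨ sum-cong-≗ (λ j → countFin≡sum (r j)) ⟨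
    sum (λ j → countFin (r j))                             ≡⟨ countPairs≡sum r ⟨
    countPairs r                                           ∎
    where open ≡-Reasoning

  countPairs≡sum-count : (r : Fin k → Fin k → Bool) → countPairs r ≡ sum (λ i → count (λ j → r i j ≟ᵇ true))
  countPairs≡sum-count r = trans (countPairs≡sum r) (sum-cong-≗ λ i → countFin≡count (r i))

  parity-odd : ∀ k → k % 2 ≡ 1 → parity k ≡ 1ℙ
  parity-odd 1             _   = refl
  parity-odd (suc (suc k)) odd = parity-odd k odd

  parity-even : ∀ k → k % 2 ≡ 0 → parity k ≡ 0ℙ
  parity-even zero          _    = refl
  parity-even (suc (suc k)) even = parity-even k even

  orient : ∀ {k} → Bool → (Fin k → Fin k → Bool) → Fin k → Fin k → Bool
  orient true  r s t = r s t
  orient false r s t = r t s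

  countPairs-orient : ∀ {k} b (r : Fin k → Fin k → Bool) → countPairs (orient b r) ≡ countPairs r
  countPairs-orient true  r = refl
  countPairs-orient false r = countPairs-flip r

  private
    <-from-+ : ∀ {x r y} → x + r ≡ y → 0 < r → x < y
    <-from-+ {x} refl 0<r = m<m+n x 0<r

    pos-from-+ : ∀ {x r y} → x + r ≡ y → x < y → 0 < r
    pos-from-+ {x} {zero}  refl x<x = contradiction (subst (x <_) (+-identityʳ x) x<x) (n≮n x)
    pos-from-+ {x} {suc r} _    _   = s≤s z≤n

    ≤-from-+ : ∀ {x r y} → x + r ≡ y → r ≤ y
    ≤-from-+ {x} {r} refl = m≤n+m r x

    +-compare : ∀ {x r y s z} → x + r ≡ y → x + s ≡ z → r < s → y < z
    +-compare {x} refl refl r<s = +-monoʳ-< x r<s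

    +-cross : ∀ {x r y s z} → x + r ≡ z → y + s ≡ z → x < y → s < r
    +-cross {x} {r} {y} {s} x+r≡z y+s≡z x<y with <-cmp s r
    ... | tri< s<r _ _ = s<r
    ... | tri≈ _ refl _ = contradiction (+-cancelʳ-≡ r x y (trans x+r≡z (sym y+s≡z))) (<⇒≢ x<y)
    ... | tri> _ _ r<s = contradiction (trans x+r≡z (sym y+s≡z)) (<⇒≢ (+-mono-< x<y r<s))

  module _ {n : ℕ} where

    cwDist : Fin n → Fin n → ℕ
    cwDist a b with toℕ a ≤? toℕ b
    ... | yes _ = toℕ b ∸ toℕ a
    ... | no  _ = n + toℕ b ∸ toℕ a

    private
      CwDist : Fin n → Fin n → ℕ → Set
      CwDist a b r = (toℕ a ≤ toℕ b × toℕ a + r ≡ toℕ b) ⊎ (toℕ b < toℕ a × toℕ a + r ≡ n + toℕ b)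

      cwDist-spec : ∀ a b → CwDist a b (cwDist a b)
      cwDist-spec a b with toℕ a ≤? toℕ b
      ... | yes a≤b = inj₁ (a≤b , m+[n∸m]≡n a≤b)
      ... | no  a≰b = inj₂ (≰⇒> a≰b , m+[n∸m]≡n (≤-trans (<⇒≤ (toℕ<n a)) (m≤m+n n (toℕ b))))

      n+x≢toℕ : ∀ {x} (c : Fin n) → ¬ (n + x ≡ toℕ c)
      n+x≢toℕ {x} c n+x≡c = m+n≮m n x (subst (_< n) (sym n+x≡c) (toℕ<n c))

    cwDist-self : ∀ a → cwDist a a ≡ 0
    cwDist-self a with cwDist-spec a a
    ... | inj₁ (_ , a+r≡a) = +-cancelˡ-≡ (toℕ a) _ 0 (trans a+r≡a (sym (+-identityʳ (toℕ a))))
    ... | inj₂ (a<a , _)   = contradiction a<a (n≮n (toℕ a))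

    cwDist-injectiveʳ : ∀ a {b c} → cwDist a b ≡ cwDist a c → b ≡ c
    cwDist-injectiveʳ a {b} {c} eq with cwDist-spec a b | cwDist-spec a c
    ... | inj₁ (_ , ab) | inj₁ (_ , ac) = toℕ-injective (trans (sym ab) (trans (cong (toℕ a +_) eq) ac))
    ... | inj₂ (_ , ab) | inj₂ (_ , ac) =
      toℕ-injective (+-cancelˡ-≡ n _ _ (trans (sym ab) (trans (cong (toℕ a +_) eq) ac)))
    ... | inj₁ (_ , ab) | inj₂ (_ , ac) = contradiction (trans (sym ac) (trans (cong (toℕ a +_) (sym eq)) ab)) (n+x≢toℕ b)
    ... | inj₂ (_ , ab) | inj₁ (_ , ac) = contradiction (trans (sym ab) (trans (cong (toℕ a +_) eq) ac)) (n+x≢toℕ c)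

    cwDist-injectiveˡ : ∀ a {b c} → cwDist b a ≡ cwDist c a → b ≡ c
    cwDist-injectiveˡ a {b} {c} eq with cwDist-spec b a | cwDist-spec c a
    ... | inj₁ (_ , ba) | inj₁ (_ , ca) =
      toℕ-injective (+-cancelʳ-≡ _ _ _ (trans (cong (toℕ b +_) (sym eq)) (trans ba (sym ca))))
    ... | inj₂ (_ , ba) | inj₂ (_ , ca) =
      toℕ-injective (+-cancelʳ-≡ _ _ _ (trans (cong (toℕ b +_) (sym eq)) (trans ba (sym ca))))
    ... | inj₁ (_ , ba) | inj₂ (_ , ca) = contradiction (+-cancelʳ-≡ _ _ _ shifted) (n+x≢toℕ c)
      where
      shifted : n + toℕ b + cwDist c a ≡ toℕ c + cwDist c a
      shifted = trans (+-assoc n (toℕ b) _) (trans (cong (λ r → n + (toℕ b + r)) (sym eq)) (trans (cong (n +_) ba) (sym ca)))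
    ... | inj₂ (_ , ba) | inj₁ (_ , ca) = contradiction (+-cancelʳ-≡ _ _ _ shifted) (n+x≢toℕ b)
      where
      shifted : n + toℕ c + cwDist b a ≡ toℕ b + cwDist b a
      shifted = trans (+-assoc n (toℕ c) _) (trans (cong (λ r → n + (toℕ c + r)) eq) (trans (cong (n +_) ca) (sym ba)))

    cwDist-pos : ∀ {a b} → a ≢ b → 0 < cwDist a b
    cwDist-pos {a} {b} a≢b = n≢0⇒n>0 λ r≡0 → a≢b (cwDist-injectiveʳ a (trans (cwDist-self a) (sym r≡0)))

    cwBetween-rotate : ∀ {a b c : Fin n} → cwBetween a b c → cwBetween b c a
    cwBetween-rotate (inj₁ (_ , a<c , c<b))     = inj₂ (c<b , inj₂ a<c)
    cwBetween-rotate (inj₂ (b<a , inj₁ a<c))   = inj₁ (<-trans b<a a<c , b<a , a<c)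
    cwBetween-rotate (inj₂ (b<a , inj₂ c<b))   = inj₂ (c<b , inj₁ b<a)

    cwBetween-from-cwDist : ∀ a b w → 0 < cwDist a w → cwDist a w < cwDist a b → cwBetween a b w
    cwBetween-from-cwDist a b w 0<aw aw<ab with cwDist-spec a w | cwDist-spec a b
    ... | inj₁ (_ , aw) | inj₁ (_ , ab) =
      let a<w = <-from-+ aw 0<aw ; w<b = +-compare aw ab aw<ab in inj₁ (<-trans a<w w<b , a<w , w<b)
    ... | inj₁ (_ , aw) | inj₂ (b<a , _) = inj₂ (b<a , inj₁ (<-from-+ aw 0<aw))
    ... | inj₂ (_ , aw) | inj₁ (_ , ab) =
      contradiction (<-trans (+-compare aw ab aw<ab) (toℕ<n b)) (m+n≮m n (toℕ w))
    ... | inj₂ (_ , aw) | inj₂ (b<a , ab) = inj₂ (b<a , inj₂ (+-cancelˡ-< n _ _ (+-compare aw ab aw<ab)))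

    cwDist-from-cwBetween : ∀ a b w → cwBetween a b w → 0 < cwDist w b × cwDist w b < cwDist a b
    cwDist-from-cwBetween a b w (inj₁ (a<b , a<w , w<b)) with cwDist-spec w b | cwDist-spec a b
    ... | inj₂ (b<w , _) | _ = contradiction (<-trans b<w w<b) (n≮n _)
    ... | inj₁ _ | inj₂ (b<a , _) = contradiction (<-trans b<a a<b) (n≮n _)
    ... | inj₁ (_ , wb) | inj₁ (_ , ab) = pos-from-+ wb w<b , +-cross ab wb a<w
    cwDist-from-cwBetween a b w (inj₂ (b<a , inj₁ a<w)) with cwDist-spec w b | cwDist-spec a b
    ... | inj₁ (w≤b , _) | _ = contradiction (≤-<-trans w≤b (<-trans b<a a<w)) (n≮n _)
    ... | inj₂ _ | inj₁ (a≤b , _) = contradiction (≤-<-trans a≤b b<a) (n≮n _)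
    ... | inj₂ (_ , wb) | inj₂ (_ , ab) =
      pos-from-+ wb (<-≤-trans (toℕ<n w) (m≤m+n n (toℕ b))) , +-cross ab wb a<w
    cwDist-from-cwBetween a b w (inj₂ (b<a , inj₂ w<b)) with cwDist-spec w b | cwDist-spec a b
    ... | inj₂ (b<w , _) | _ = contradiction (<-trans b<w w<b) (n≮n _)
    ... | inj₁ _ | inj₁ (a≤b , _) = contradiction (≤-<-trans a≤b b<a) (n≮n _)
    ... | inj₁ (_ , wb) | inj₂ (_ , ab) = pos-from-+ wb w<b , ≤-<-trans (≤-from-+ wb) b<ab
      where
      b<ab : toℕ b < cwDist a b
      b<ab = +-cancelˡ-< (toℕ a) _ _ (subst (toℕ a + toℕ b <_) (sym ab) (+-monoˡ-< (toℕ b) (toℕ<n a)))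

    dist : Parity → Fin n → Fin n → ℕ
    dist 1ℙ y w = cwDist y w
    dist 0ℙ y w = cwDist w y

    dist-injective : ∀ π y {a b} → dist π y a ≡ dist π y b → a ≡ b
    dist-injective 1ℙ y = cwDist-injectiveʳ y
    dist-injective 0ℙ y = cwDist-injectiveˡ y

    dist-pos : ∀ π {y w} → w ≢ y → 0 < dist π y w
    dist-pos 1ℙ {y} {w} w≢y = cwDist-pos {y} {w} λ { refl → w≢y refl }
    dist-pos 0ℙ {y} {w} w≢y = cwDist-pos {w} {y} w≢y

    Between : Parity → Fin n → Fin n → Pred (Fin n) 0ℓ
    Between π y f w = 0 < dist π y w × dist π y w < dist π y f

    between? : ∀ π y f → Decidable (Between π y f)
    between? π y f w = (0 <? dist π y w) ×-dec (dist π y w <? dist π y f)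

    -- Avoids (parity |V(P)|) x y z is the side condition of Good on the image z of a vertex.
    Avoids : Parity → Fin n → Fin n → Fin n → Set
    Avoids 1ℙ x y z = ¬ cwBetween x y z
    Avoids 0ℙ x y z = ¬ cwOutside x y z

    avoids⇒¬between : ∀ π {y f w} → Avoids π y f w → ¬ Between π y f w
    avoids⇒¬between 1ℙ {y} {f} {w} avoid (0<yw , yw<yf) = avoid (cwBetween-from-cwDist y f w 0<yw yw<yf)
    avoids⇒¬between 0ℙ {y} {f} {w} avoid (0<wy , wy<fy) = avoid (w≢y , w≢f , ¬between)
      where
      w≢y : w ≢ y
      w≢y refl = contradiction (subst (0 <_) (cwDist-self w) 0<wy) (n≮n 0)
      w≢f : w ≢ f
      w≢f refl = n≮n _ wy<fy
      ¬between : ¬ cwBetween y f w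
      ¬between yfw = <-asym wy<fy (proj₂ (cwDist-from-cwBetween w y f (cwBetween-rotate (cwBetween-rotate yfw))))

    ¬between⇒avoids : ∀ π {x y w} → x ≢ y → ¬ Between π y x w → Avoids (π ⁻¹) x y w
    ¬between⇒avoids 1ℙ {x} {y} {w} x≢y ¬between (w≢x , w≢y , ¬xyw) =
      ¬between (cwDist-pos {y} {w} (λ { refl → w≢y refl }) , yw<yx)
      where
      yw<yx : cwDist y w < cwDist y x
      yw<yx with <-cmp (cwDist y w) (cwDist y x)
      ... | tri< yw<yx _ _ = yw<yx
      ... | tri≈ _ yw≡yx _ = contradiction (cwDist-injectiveʳ y yw≡yx) w≢x
      ... | tri> _ _ yx<yw = contradiction
        (cwBetween-rotate (cwBetween-rotate (cwBetween-from-cwDist y w x (cwDist-pos {y} {x} (λ { refl → x≢y refl })) yx<yw)))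
        ¬xyw
    ¬between⇒avoids 0ℙ {x} {y} {w} _ ¬between xyw = ¬between (cwDist-from-cwBetween x y w xyw)

  any-allFin⁺ : (p : Fin k → Bool) {z : Fin k} → p z ≡ true → any p (allFin k) ≡ true
  any-allFin⁺ p {z} pz = Equivalence.to T-≡ (any⁺ p (lose (∈-allFin z) (Equivalence.from T-≡ pz)))

  any-allFin⁻ : (p : Fin k → Bool) → any p (allFin k) ≡ true → ∃[ z ] p z ≡ true
  any-allFin⁻ {k} p any≡true with satisfied (any⁻ p (allFin k) (Equivalence.from T-≡ any≡true))
  ... | z , pz = z , Equivalence.to T-≡ pz

  orientedArc : Digraph k → Bool → Fin k → Fin k → Bool
  orientedArc G true  y w = arc G y w
  orientedArc G false y w = arc G w y

  orientedArc-irrefl : (G : Digraph k) (o : Bool) (y : Fin k) → orientedArc G o y y ≡ false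
  orientedArc-irrefl G true  y = loopless G y
  orientedArc-irrefl G false y = loopless G y

  countPairs-orientedArc : (G : Digraph k) (o : Bool) → countPairs (orientedArc G o) ≡ a G
  countPairs-orientedArc G true  = refl
  countPairs-orientedArc G false = countPairs-flip (arc G)

  degPos : Digraph k → Bool → ℕ
  degPos {k} G o = countFin λ y → any (orientedArc G o y) (allFin k)

  module Caterpillar {m : ℕ} {T : Digraph m} (C : AntidirectedCaterpillar T) where

    Adjacent : Fin m → Fin m → Set
    Adjacent x y = arc T x y ≡ true ⊎ arc T y x ≡ true

    adjacent-sym : ∀ {x y} → Adjacent x y → Adjacent y x
    adjacent-sym (inj₁ xy) = inj₂ xy
    adjacent-sym (inj₂ yx) = inj₁ yx

    hasOut hasIn : Fin m → Bool
    hasOut x = any (arc T x) (allFin m)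
    hasIn  y = any (λ x → arc T x y) (allFin m)

    hasOut-source : ∀ {x y} → arc T x y ≡ true → hasOut x ≡ true
    hasOut-source = any-allFin⁺ (arc T _)

    hasIn-target : ∀ {x y} → arc T x y ≡ true → hasIn y ≡ true
    hasIn-target = any-allFin⁺ (λ x → arc T x _)

    hasOut-target : ∀ {x y} → arc T x y ≡ true → hasOut y ≡ false
    hasOut-target {x} {y} xy with hasOut y in eq
    ... | false = refl
    ... | true with any-allFin⁻ (arc T y) eq
    ...   | z , yz = contradiction (trans (sym yz) (antidirected C x y z xy)) λ ()

    arc-orientation : ∀ {v p} → Adjacent v p → orientedArc T (hasOut p) p v ≡ true
    arc-orientation {v} {p} (inj₁ vp) rewrite hasOut-target vp = vp
    arc-orientation {v} {p} (inj₂ pv) rewrite hasOut-source pv = pv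

    L : ℕ
    L = len C

    Leaf : Pred (Fin m) 0ℓ
    Leaf w = ∀ i → spine C i ≢ w

    leaf? : Decidable Leaf
    leaf? w = all? λ i → ¬? (spine C i ≟ w)

    spine-or-leaf : ∀ w → ∃[ i ] spine C i ≡ w ⊎ Leaf w
    spine-or-leaf w with any? (λ i → spine C i ≟ w)
    ... | yes onSpine = inj₁ onSpine
    ... | no  ¬onSpine = inj₂ λ i e → ¬onSpine (i , e)

    level : Fin m → ℕ
    level w with spine-or-leaf w
    ... | inj₁ (i , _) = toℕ i
    ... | inj₂ _       = pred (toℕ (attach C w))

    level-spine : ∀ i → level (spine C i) ≡ toℕ i
    level-spine i with spine-or-leaf (spine C i)
    ... | inj₁ (j , e) = cong toℕ (spine-injective C j i e)
    ... | inj₂ leaf    = contradiction refl (leaf i)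

    attach-leaf : ∀ {w} → Leaf w → toℕ (attach C w) ≡ suc (level w) × level w < L
    attach-leaf {w} leaf with spine-or-leaf w
    ... | inj₁ (i , e) = contradiction e (leaf i)
    ... | inj₂ _       = inner (attach-inner C w leaf)
      where
      inner : ∀ {t} → 1 ≤ t × suc t < suc (suc L) → t ≡ suc (pred t) × pred t < L
      inner (s≤s _ , s≤s (s≤s j<L)) = refl , j<L

    spineIndex : ℕ → Fin (suc (suc L))
    spineIndex i = fromℕ< (s≤s (m⊓n≤n i (suc L)))

    toℕ-spineIndex : ∀ {i} → i ≤ suc L → toℕ (spineIndex i) ≡ i
    toℕ-spineIndex i≤ = trans (toℕ-fromℕ< _) (m≤n⇒m⊓n≡m i≤)

    spineAt : ℕ → Fin m
    spineAt i = spine C (spineIndex i)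

    spine≡spineAt : ∀ j → spine C j ≡ spineAt (toℕ j)
    spine≡spineAt j = cong (spine C) (toℕ-injective (sym (toℕ-spineIndex (s≤s⁻¹ (toℕ<n j)))))

    level-spineAt : ∀ {i} → i ≤ suc L → level (spineAt i) ≡ i
    level-spineAt i≤ = trans (level-spine _) (toℕ-spineIndex i≤)

    spineAt-nonleaf : ∀ {i} → ¬ Leaf (spineAt i)
    spineAt-nonleaf leaf = leaf _ refl

    adjacent-above : ∀ {v b} → Adjacent v b → level v ≤ level b → b ≡ spineAt (suc (level v))
    adjacent-above {v} {b} adj v≤b with Equivalence.to (edges C v b) adj
    ... | inj₁ (i , j , j≡1+i , inj₁ (refl , refl)) =
      trans (spine≡spineAt j) (cong spineAt (trans j≡1+i (cong suc (sym (level-spine i)))))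
    ... | inj₁ (i , j , j≡1+i , inj₂ (refl , refl)) =
      contradiction (subst₂ _≤_ (trans (level-spine j) j≡1+i) (level-spine i) v≤b) (n≮n _)
    ... | inj₂ (inj₁ (leaf , refl)) =
      trans (spine≡spineAt (attach C v)) (cong spineAt (proj₁ (attach-leaf leaf)))
    ... | inj₂ (inj₂ (leaf , refl)) =
      contradiction (subst (_≤ level b) (trans (level-spine (attach C b)) (proj₁ (attach-leaf leaf))) v≤b) (n≮n _)

    adjacent-leaf : ∀ {v} → Leaf v → Adjacent v (spineAt (suc (level v)))
    adjacent-leaf {v} leaf = Equivalence.from (edges C v _) (inj₂ (inj₁ (leaf , parent)))
      where
      parent : spineAt (suc (level v)) ≡ spine C (attach C v)
      parent = sym (trans (spine≡spineAt (attach C v)) (cong spineAt (proj₁ (attach-leaf leaf))))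

    adjacent-spine : ∀ {c} → c ≤ L → Adjacent (spineAt c) (spineAt (suc c))
    adjacent-spine {c} c≤L = Equivalence.from (edges C _ _)
      (inj₁ (spineIndex c , spineIndex (suc c) , consecutive , inj₁ (refl , refl)))
      where
      consecutive : toℕ (spineIndex (suc c)) ≡ suc (toℕ (spineIndex c))
      consecutive = trans (toℕ-spineIndex (s≤s c≤L)) (cong suc (sym (toℕ-spineIndex (m≤n⇒m≤1+n c≤L))))

    top-level : ∀ {w} → L ≤ level w → w ≡ spineAt L ⊎ w ≡ spineAt (suc L)
    top-level {w} L≤w = by-kind (spine-or-leaf w)
      where
      by-kind : ∃[ i ] spine C i ≡ w ⊎ Leaf w → w ≡ spineAt L ⊎ w ≡ spineAt (suc L)
      by-kind (inj₂ leaf) = contradiction L≤w (<⇒≱ (proj₂ (attach-leaf leaf)))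
      by-kind (inj₁ (i , e)) with m≤n⇒m<n∨m≡n (subst (L ≤_) (trans (cong level (sym e)) (level-spine i)) L≤w)
      ... | inj₂ L≡i = inj₁ (trans (sym e) (trans (spine≡spineAt i) (cong spineAt (sym L≡i))))
      ... | inj₁ L<i = inj₂ (trans (sym e) (trans (spine≡spineAt i) (cong spineAt (≤-antisym (s≤s⁻¹ (toℕ<n i)) L<i))))

    -- A leaf attached to p_{i+1} has level i, so Tail c is p_c … p_{L+1} with the leaves of p_{c+1} … p_L.
    Tail : ℕ → Pred (Fin m) 0ℓ
    Tail c w = c ≤ level w

    tail? : ∀ c → Decidable (Tail c)
    tail? c w = c ≤? level w

  module _ {n : ℕ} (D : Digraph n) {m : ℕ} {T : Digraph m} (C : AntidirectedCaterpillar T) where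

    open Caterpillar C

    weight : Fin m → ℕ
    weight w = (if hasIn w then outPos D else 0) + (if hasOut w then inPos D else 0)

    weightOf : {W : Pred (Fin m) 0ℓ} → Decidable W → ℕ
    weightOf W? = sumOver W? weight

    weightOf-full : {W : Pred (Fin m) 0ℓ} (W? : Decidable W) → (∀ w → W w) →
                    weightOf W? ≡ inPos T * outPos D + outPos T * inPos D
    weightOf-full W? everywhere = begin
      weightOf W?                                    ≡⟨ sum-cong-≗ unrestricted ⟩
      sum weight                                     ≡⟨ ∑-distrib-+ weightIn weightOut ⟩
      sum weightIn + sum weightOut                   ≡⟨ cong₂ _+_ (sum-if hasIn (outPos D)) (sum-if hasOut (inPos D)) ⟩
      inPos T * outPos D + outPos T * inPos D        ∎
      where
      open ≡-Reasoning
      weightIn weightOut : Fin m → ℕ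
      weightIn  w = if hasIn w then outPos D else 0
      weightOut w = if hasOut w then inPos D else 0
      unrestricted : ∀ w → (if does (W? w) then weight w else 0) ≡ weight w
      unrestricted w with W? w
      ... | yes _   = refl
      ... | no ¬Ww = contradiction (everywhere w) ¬Ww

    weight-source : ∀ {x y} → arc T x y ≡ true → inPos D ≤ weight x
    weight-source {x} xy =
      subst (λ b → inPos D ≤ (if hasIn x then outPos D else 0) + (if b then inPos D else 0))
            (sym (hasOut-source xy)) (m≤n+m (inPos D) _)

    weight-target : ∀ {x y} → arc T x y ≡ true → outPos D ≤ weight y
    weight-target {y = y} xy =
      subst (λ b → outPos D ≤ (if b then outPos D else 0) + (if hasOut y then inPos D else 0))
            (sym (hasIn-target xy)) (m≤m+n (outPos D) _)

    degPos-≤-weight : ∀ {v p} → Adjacent v p → degPos D (hasOut p) ≤ weight v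
    degPos-≤-weight {v} {p} adj with hasOut p | arc-orientation adj
    ... | true  | pv = weight-target pv
    ... | false | vp = weight-source vp

    weight-adjacent : ∀ {x y} → Adjacent x y → outPos D + inPos D ≤ weight x + weight y
    weight-adjacent {x} {y} (inj₁ xy) =
      subst (_≤ weight x + weight y) (+-comm (inPos D) (outPos D)) (+-mono-≤ (weight-source xy) (weight-target xy))
    weight-adjacent (inj₂ yx) = +-mono-≤ (weight-target yx) (weight-source yx)

    record EmbeddingOn (W : Pred (Fin m) 0ℓ) (g : Fin m → Fin n) : Set where
      field
        injectiveOn : ∀ {x y} → W x → W y → g x ≡ g y → x ≡ y
        arcsOn      : ∀ {x y} → W x → W y → arc T x y ≡ true → arc D (g x) (g y) ≡ true
    open EmbeddingOn

    EmbeddingOn-restrict : ∀ {W W′ g} → W′ ⊆ W → EmbeddingOn W g → EmbeddingOn W′ g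
    EmbeddingOn-restrict W′⊆W E = record
      { injectiveOn = λ Wx Wy → injectiveOn E (W′⊆W Wx) (W′⊆W Wy)
      ; arcsOn      = λ Wx Wy → arcsOn E (W′⊆W Wx) (W′⊆W Wy)
      }

    EmbeddingOn-singleton : ∀ p z → EmbeddingOn ｛ p ｝ (const z)
    EmbeddingOn-singleton p z = record
      { injectiveOn = λ { refl refl _ → refl }
      ; arcsOn      = λ { refl refl pp → contradiction (trans (sym pp) (loopless T p)) λ () }
      }

    orientedArc-preserved : ∀ {W g x y} o → EmbeddingOn W g → W x → W y →
                            orientedArc T o x y ≡ true → orientedArc D o (g x) (g y) ≡ true
    orientedArc-preserved true  E Wx Wy = arcsOn E Wx Wy
    orientedArc-preserved false E Wx Wy = arcsOn E Wy Wx

    updateAt-cases : ∀ (g : Fin m → Fin n) v z w → updateAt g v (const z) w ≡ z ⊎ updateAt g v (const z) w ≡ g w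
    updateAt-cases g v z w with w ≟ v
    ... | yes refl = inj₁ (updateAt-updates v g)
    ... | no w≢v   = inj₂ (updateAt-minimal w v g w≢v)

    EmbeddingOn-attach : ∀ {W W′ g v p z} → EmbeddingOn W g → ¬ W v → W′ ⊆ W ∪ ｛ v ｝ → W p →
                         (∀ {w} → W w → Adjacent v w → w ≡ p) →
                         orientedArc D (hasOut p) (g p) z ≡ true → (∀ {w} → W w → g w ≢ z) →
                         EmbeddingOn W′ (updateAt g v (const z))
    EmbeddingOn-attach {W} {W′} {g} {v} {p} {z} E ¬Wv W′⊆W∪v Wp only-p gp→z fresh = record
      { injectiveOn = injective′ ; arcsOn = arcs′ }
      where
      g′ : Fin m → Fin n
      g′ = updateAt g v (const z)
      g′v : g′ v ≡ z
      g′v = updateAt-updates v g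
      g′w : ∀ {w} → W w → g′ w ≡ g w
      g′w {w} Ww = updateAt-minimal w v g λ { refl → ¬Wv Ww }
      out-of-p : arc T p v ≡ true → arc D (g p) z ≡ true
      out-of-p pv = subst (λ o → orientedArc D o (g p) z ≡ true) (hasOut-source pv) gp→z
      into-p : arc T v p ≡ true → arc D z (g p) ≡ true
      into-p vp = subst (λ o → orientedArc D o (g p) z ≡ true) (hasOut-target vp) gp→z
      injective′ : ∀ {x y} → W′ x → W′ y → g′ x ≡ g′ y → x ≡ y
      injective′ W′x W′y g′x≡g′y with W′⊆W∪v W′x | W′⊆W∪v W′y
      ... | inj₁ Wx | inj₁ Wy = injectiveOn E Wx Wy (trans (sym (g′w Wx)) (trans g′x≡g′y (g′w Wy)))
      ... | inj₁ Wx | inj₂ refl = contradiction (trans (sym (g′w Wx)) (trans g′x≡g′y g′v)) (fresh Wx)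
      ... | inj₂ refl | inj₁ Wy = contradiction (trans (sym (g′w Wy)) (trans (sym g′x≡g′y) g′v)) (fresh Wy)
      ... | inj₂ refl | inj₂ refl = refl
      arcs′ : ∀ {x y} → W′ x → W′ y → arc T x y ≡ true → arc D (g′ x) (g′ y) ≡ true
      arcs′ W′x W′y xy with W′⊆W∪v W′x | W′⊆W∪v W′y
      ... | inj₁ Wx | inj₁ Wy rewrite g′w Wx | g′w Wy = arcsOn E Wx Wy xy
      ... | inj₁ Wx | inj₂ refl with only-p Wx (inj₂ xy)
      ...   | refl rewrite g′w Wp | g′v = out-of-p xy
      arcs′ W′x W′y xy | inj₂ refl | inj₁ Wy with only-p Wy (inj₁ xy)
      ...   | refl rewrite g′w Wp | g′v = into-p xy
      arcs′ W′x W′y xy | inj₂ refl | inj₂ refl = contradiction (trans (sym xy) (loopless T v)) λ ()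

    module Greedy (p : Fin m) (π : Parity) where

      Neighbour : Fin n → Pred (Fin n) 0ℓ
      Neighbour y w = orientedArc D (hasOut p) y w ≡ true

      Available : Fin n → Fin n → Pred (Fin n) 0ℓ
      Available y f w = Neighbour y w × Between π y f w

      neighbour-irrefl : ∀ {y w} → Neighbour y w → w ≢ y
      neighbour-irrefl {y} yw refl = contradiction (trans (sym yw) (orientedArc-irrefl D (hasOut p) y)) λ ()

      available? : ∀ y f → Decidable (Available y f)
      available? y f w = (orientedArc D (hasOut p) y w ≟ᵇ true) ×-dec between? π y f w

      record Frontier (W : Pred (Fin m) 0ℓ) (y f : Fin n) : Set where
        field
          map    : Fin m → Fin n
          map-p  : map p ≡ y
          embeds : EmbeddingOn W map
          clear  : ∀ {w} → W w → ¬ Between π y f (map w)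

      Frontier-restrict : ∀ {W W′ y f} → W′ ⊆ W → Frontier W y f → Frontier W′ y f
      Frontier-restrict W′⊆W F = record
        { map = map ; map-p = map-p ; embeds = EmbeddingOn-restrict W′⊆W embeds ; clear = λ W′w → clear (W′⊆W W′w) }
        where open Frontier F

      Frontier-attach : ∀ {W W′ y f v z} → Frontier W y f → ¬ W v → W′ ⊆ W ∪ ｛ v ｝ → W p →
                        (∀ {w} → W w → Adjacent v w → w ≡ p) → Available y f z →
                        Σ (Frontier W′ y z) λ F′ → Frontier.map F′ v ≡ z
      Frontier-attach {W} {W′} {y} {f} {v} {z} F ¬Wv W′⊆W∪v Wp only-p (yz , yfz) =
        record { map = map′ ; map-p = map′-p ; embeds = embeds′ ; clear = clear′ } , updateAt-updates v map
        where
        open Frontier F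
        map′ : Fin m → Fin n
        map′ = updateAt map v (const z)
        map′-old : ∀ {w} → W w → map′ w ≡ map w
        map′-old {w} Ww = updateAt-minimal w v map λ { refl → ¬Wv Ww }
        map′-p : map′ p ≡ y
        map′-p = trans (map′-old Wp) map-p
        fresh : ∀ {w} → W w → map w ≢ z
        fresh Ww refl = clear Ww yfz
        embeds′ : EmbeddingOn W′ map′
        embeds′ = EmbeddingOn-attach embeds ¬Wv W′⊆W∪v Wp only-p (subst (λ x → Neighbour x z) (sym map-p) yz) fresh
        clear′ : ∀ {w} → W′ w → ¬ Between π y z (map′ w)
        clear′ W′w with W′⊆W∪v W′w
        ... | inj₁ Ww = λ between-yz → clear Ww (narrow (subst (Between π y z) (map′-old Ww) between-yz))
          where
          narrow : ∀ {x} → Between π y z x → Between π y f x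
          narrow (0<yx , yx<yz) = 0<yx , <-trans yx<yz (proj₂ yfz)
        ... | inj₂ refl = λ (_ , yv<yz) → n≮n _ (subst (λ x → dist π y x < dist π y z) (updateAt-updates v map) yv<yz)

      data Potential (W : Pred (Fin m) 0ℓ) (y : Fin n) : ℕ → Set where
        exhausted : Potential W y 0
        frontier  : ∀ f → Frontier W y f → Potential W y (count (available? y f))

      Potential-restrict : ∀ {W W′ y q} → W′ ⊆ W → Potential W y q → Potential W′ y q
      Potential-restrict W′⊆W exhausted      = exhausted
      Potential-restrict W′⊆W (frontier f F) = frontier f (Frontier-restrict W′⊆W F)

      Candidate : ∀ {W y q} → Potential W y q → Pred (Fin n) 0ℓ
      Candidate exhausted                = ∅
      Candidate {y = y} (frontier f _)   = Available y f

      candidate? : ∀ {W y q} (P : Potential W y q) → Decidable (Candidate P)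
      candidate? exhausted _               = no λ ()
      candidate? {y = y} (frontier f _)    = available? y f

      candidate-frontier : ∀ {W y q} (P : Potential W y q) {w} → Candidate P w → ∃[ f ] Frontier W y f × Available y f w
      candidate-frontier (frontier f F) avail = f , F , avail

      count-candidate : ∀ {W y q} (P : Potential W y q) → count (candidate? P) ≡ q
      count-candidate {W} {y} exhausted = count-∅ (candidate? {W} {y} exhausted) λ _ ()
      count-candidate (frontier f _)    = refl

      record Potentials (W : Pred (Fin m) 0ℓ) : Set where
        field
          value     : Fin n → ℕ
          potential : ∀ y → Potential W y (value y)

      Potentials-restrict : ∀ {W W′} → W′ ⊆ W → Potentials W → Potentials W′
      Potentials-restrict W′⊆W P = record { value = value ; potential = λ y → Potential-restrict W′⊆W (potential y) }
        where open Potentials P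

      hasNeighbour : Fin n → ℕ
      hasNeighbour y = if any (orientedArc D (hasOut p) y) (allFin n) then 1 else 0

      hasNeighbour-≡1 : ∀ {y w} → Neighbour y w → hasNeighbour y ≡ 1
      hasNeighbour-≡1 {y} yw rewrite any-allFin⁺ (orientedArc D (hasOut p) y) yw = refl

      sum-hasNeighbour : sum hasNeighbour ≡ degPos D (hasOut p)
      sum-hasNeighbour = sym (countFin≡sum (λ y → any (orientedArc D (hasOut p) y) (allFin n)))

      -- The farthest candidate from y becomes the new frontier: every other candidate
      -- lies strictly between y and it, so at most one candidate is lost.
      advance : ∀ {W S y} (S? : Decidable S) → (∀ {w} → S w → Neighbour y w × 0 < dist π y w) →
                (∀ {f} → S f → Frontier W y f) →
                ∃[ q ] Potential W y q × count S? ≤ q + hasNeighbour y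
      advance {S = S} {y = y} S? admissible front with farthest S? (dist π y)
      ... | inj₁ none = 0 , exhausted , ≤-trans (≤-reflexive (count-∅ S? none)) z≤n
      ... | inj₂ (f , Sf , max) = count (available? y f) , frontier f (front Sf) , bound
        where
        below : S ⊆ Available y f ∪ ｛ f ｝
        below {w} Sw with f ≟ w | admissible Sw
        ... | yes f≡w | _          = inj₂ f≡w
        ... | no  f≢w | yw , 0<yw = inj₁ (yw , 0<yw , ≤∧≢⇒< (max w Sw) λ eq → f≢w (sym (dist-injective π y eq)))
        bound : count S? ≤ count (available? y f) + hasNeighbour y
        bound = begin
          count S?                                 ≤⟨ sumOver-⊆-insert S? (available? y f) (const 1) f below ⟩
          count (available? y f) + 1               ≡⟨ cong (count (available? y f) +_) (hasNeighbour-≡1 (proj₁ (admissible Sf))) ⟨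
          count (available? y f) + hasNeighbour y  ∎
          where open ≤-Reasoning

      record Advance (W : Pred (Fin m) 0ℓ) (before : ℕ) : Set where
        field
          next : Potentials W
          lost : before ≤ sum (Potentials.value next) + degPos D (hasOut p)

      advance-all : ∀ {W} {S : Fin n → Pred (Fin n) 0ℓ} (S? : ∀ y → Decidable (S y)) →
                    (∀ {y w} → S y w → Neighbour y w × 0 < dist π y w) →
                    (∀ {y f} → S y f → Frontier W y f) →
                    Advance W (sum λ y → count (S? y))
      advance-all {W} S? admissible front = record { next = record { value = value ; potential = potential } ; lost = bound }
        where
        step : ∀ y → ∃[ q ] Potential W y q × count (S? y) ≤ q + hasNeighbour y
        step y = advance (S? y) admissible front
        value : Fin n → ℕ
        value y = proj₁ (step y)
        potential : ∀ y → Potential W y (value y)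
        potential y = proj₁ (proj₂ (step y))
        bound : sum (λ y → count (S? y)) ≤ sum value + degPos D (hasOut p)
        bound = begin
          sum (λ y → count (S? y))                ≤⟨ sum-mono-≤ (λ y → proj₂ (proj₂ (step y))) ⟩
          sum (λ y → value y + hasNeighbour y)    ≡⟨ ∑-distrib-+ value hasNeighbour ⟩
          sum value + sum hasNeighbour            ≡⟨ cong (sum value +_) sum-hasNeighbour ⟩
          sum value + degPos D (hasOut p)         ∎
          where open ≤-Reasoning

    record Placement (c : ℕ) (π : Parity) (x y : Fin n) : Set where
      field
        map      : Fin m → Fin n
        map-low  : map (spineAt c) ≡ x
        map-high : map (spineAt (suc c)) ≡ y
        embeds   : EmbeddingOn (Tail c) map
        avoids   : ∀ {w} → Tail c w → Avoids π x y (map w)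

    record Stage (c : ℕ) (π : Parity) : Set where
      field
        pairs  : Fin n → Fin n → Bool
        placed : ∀ {x y} → pairs x y ≡ true → Placement c π x y
        bound  : a D + outPos D + inPos D ≤ countPairs pairs + weightOf (tail? c)

    weight-pair-≤ : ∀ {W} (W? : Decidable W) {x y} → x ≢ y → W x → W y →
                    weight x + weight y ≤ weightOf W?
    weight-pair-≤ W? {x} {y} x≢y Wx Wy =
      subst (λ s → s + weight y ≤ weightOf W?) (sumOver-singleton x weight)
            (sumOver-insert (x ≟_) W? weight y (λ { refl → Wx }) Wy x≢y)

    stage-top : Stage L 0ℙ
    stage-top = record { pairs = orientedArc D (hasOut low) ; placed = placed ; bound = bound }
      where
      low high : Fin m
      low  = spineAt L
      high = spineAt (suc L)
      level-low : level low ≡ L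
      level-low = level-spineAt (n≤1+n L)
      level-high : level high ≡ suc L
      level-high = level-spineAt ≤-refl
      low≢high : low ≢ high
      low≢high eq = 1+n≢n (trans (sym level-high) (trans (cong level (sym eq)) level-low))
      placed : ∀ {y z} → orientedArc D (hasOut low) y z ≡ true → Placement L 0ℙ y z
      placed {y} {z} yz = record
        { map      = map
        ; map-low  = updateAt-minimal low high (const y) low≢high
        ; map-high = updateAt-updates high (const y)
        ; embeds   = EmbeddingOn-attach (EmbeddingOn-singleton low y) low≢high top refl (λ low≡w _ → sym low≡w) yz
                       (λ _ → y≢z)
        ; avoids   = λ _ → at-endpoint
        }
        where
        map : Fin m → Fin n
        map = updateAt (const y) high (const z)
        y≢z : y ≢ z
        y≢z refl = contradiction (trans (sym yz) (orientedArc-irrefl D (hasOut low) y)) λ ()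
        top : Tail L ⊆ ｛ low ｝ ∪ ｛ high ｝
        top L≤w with top-level L≤w
        ... | inj₁ w≡low  = inj₁ (sym w≡low)
        ... | inj₂ w≡high = inj₂ (sym w≡high)
        at-endpoint : ∀ {w} → ¬ cwOutside y z (map w)
        at-endpoint {w} (≢y , ≢z , _) with updateAt-cases (const y) high z w
        ... | inj₁ ≡z = ≢z ≡z
        ... | inj₂ ≡y = ≢y ≡y
      bound : a D + outPos D + inPos D ≤ countPairs (orientedArc D (hasOut low)) + weightOf (tail? L)
      bound = begin
        a D + outPos D + inPos D                         ≡⟨ +-assoc (a D) (outPos D) (inPos D) ⟩
        a D + (outPos D + inPos D)                       ≤⟨ +-mono-≤ (≤-reflexive (sym (countPairs-orientedArc D (hasOut low))))
                                                                     (weight-adjacent (adjacent-spine ≤-refl)) ⟩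
        arcCount + (weight low + weight high)            ≤⟨ +-monoʳ-≤ arcCount (weight-pair-≤ (tail? L) low≢high low∈tail high∈tail) ⟩
        arcCount + weightOf (tail? L)                    ∎
        where
        open ≤-Reasoning
        arcCount : ℕ
        arcCount = countPairs (orientedArc D (hasOut low))
        low∈tail : Tail L low
        low∈tail = ≤-reflexive (sym level-low)
        high∈tail : Tail L high
        high∈tail = subst (L ≤_) (sym level-high) (n≤1+n L)

    module Step {c : ℕ} (c<L : suc c ≤ L) {π : Parity} (S : Stage (suc c) π) where

      open Stage S

      low p : Fin m
      low = spineAt c
      p   = spineAt (suc c)

      open Greedy p π

      level-low : level low ≡ c
      level-low = level-spineAt (≤-trans (n≤1+n c) (≤-trans c<L (n≤1+n L)))

      level-p : level p ≡ suc c
      level-p = level-spineAt (m≤n⇒m≤1+n c<L)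

      Partial : ℕ → Pred (Fin m) 0ℓ
      Partial l w = Tail (suc c) w ⊎ (Leaf w × level w ≡ c × toℕ w < l)

      partial? : ∀ l → Decidable (Partial l)
      partial? l w = tail? (suc c) w ⊎-dec (leaf? w ×-dec (level w ℕ.≟ c ×-dec toℕ w <? l))

      partial-level : ∀ {l w} → Partial l w → c ≤ level w
      partial-level (inj₁ c<w)           = ≤-trans (n≤1+n c) c<w
      partial-level (inj₂ (_ , w≡c , _)) = ≤-reflexive (sym w≡c)

      partial-p : ∀ {l} → Partial l p
      partial-p = inj₁ (≤-reflexive (sym level-p))

      attached-at-p : ∀ {l v w} → level v ≡ c → Partial l w → Adjacent v w → w ≡ p
      attached-at-p v≡c Pw adj =
        trans (adjacent-above adj (subst (_≤ _) (sym v≡c) (partial-level Pw))) (cong (spineAt ∘ suc) v≡c)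

      d : ℕ
      d = degPos D (hasOut p)

      paid-by : ∀ {v w w′} → Adjacent v p → w + weight v ≤ w′ → d + w ≤ w′
      paid-by {v} {w} {w′} adj inserted = begin
        d + w           ≡⟨ +-comm d w ⟩
        w + d           ≤⟨ +-monoʳ-≤ w (degPos-≤-weight adj) ⟩
        w + weight v    ≤⟨ inserted ⟩
        w′              ∎
        where open ≤-Reasoning

      -- The summand d is owed for the pairs lost by the latest greedy choice; it is paid by
      -- the next vertex attached to p.
      record Progress (l : ℕ) : Set where
        field
          potentials : Potentials (Partial l)
          progress   : a D + outPos D + inPos D ≤ sum (Potentials.value potentials) + d + weightOf (partial? l)

      placement-frontier : ∀ {y f} → Placement (suc c) π y f → Frontier (Partial 0) y f
      placement-frontier P = record
        { map    = map
        ; map-p  = map-low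
        ; embeds = EmbeddingOn-restrict partial-0 embeds
        ; clear  = λ P0w → avoids⇒¬between π (avoids (partial-0 P0w))
        }
        where
        open Placement P
        partial-0 : Partial 0 ⊆ Tail (suc c)
        partial-0 (inj₁ c<w) = c<w

      placement-neighbour : ∀ {y f} → Placement (suc c) π y f → Neighbour y f × 0 < dist π y f
      placement-neighbour {y} {f} P = yf , dist-pos π (neighbour-irrefl yf)
        where
        open Placement P
        yf : Neighbour y f
        yf = subst₂ Neighbour map-low map-high
               (orientedArc-preserved (hasOut p) embeds (≤-reflexive (sym level-p))
                 (subst (suc c ≤_) (sym (level-spineAt (s≤s c<L))) (n≤1+n (suc c)))
                 (arc-orientation (adjacent-sym (adjacent-spine c<L))))

      initial : Progress 0
      initial = record { potentials = next ; progress = bound′ }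
        where
        advanced : Advance (Partial 0) (sum λ y → count (λ f → pairs y f ≟ᵇ true))
        advanced = advance-all (λ y f → pairs y f ≟ᵇ true) (placement-neighbour ∘ placed) (placement-frontier ∘ placed)
        open Advance advanced
        bound′ : a D + outPos D + inPos D ≤ sum (Potentials.value next) + d + weightOf (partial? 0)
        bound′ = begin
          a D + outPos D + inPos D                                   ≤⟨ bound ⟩
          countPairs pairs + weightOf (tail? (suc c))                ≡⟨ cong (_+ _) (countPairs≡sum-count pairs) ⟩
          sum (λ y → count (λ f → pairs y f ≟ᵇ true))
            + weightOf (tail? (suc c))                               ≤⟨ +-mono-≤ lost (sumOver-mono (tail? (suc c)) (partial? 0) weight inj₁) ⟩
          sum (Potentials.value next) + d + weightOf (partial? 0)    ∎
          where open ≤-Reasoning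

      module _ {l : ℕ} (v : Fin m) (v≡l : toℕ v ≡ l) where

        partial-grow : Partial l ⊆ Partial (suc l)
        partial-grow (inj₁ c<w)              = inj₁ c<w
        partial-grow (inj₂ (leaf , w≡c , w<l)) = inj₂ (leaf , w≡c , m<n⇒m<1+n w<l)

        partial-suc : ∀ {w} → Partial (suc l) w → Partial l w ⊎ (v ≡ w × Leaf v × level v ≡ c)
        partial-suc (inj₁ c<w) = inj₁ (inj₁ c<w)
        partial-suc {w} (inj₂ (leaf , w≡c , w<1+l)) with toℕ w ℕ.≟ l
        ... | no  w≢l = inj₁ (inj₂ (leaf , w≡c , ≤∧≢⇒< (s≤s⁻¹ w<1+l) w≢l))
        ... | yes w≡l with toℕ-injective (trans v≡l (sym w≡l))
        ...   | refl = inj₂ (refl , leaf , w≡c)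

        grow : Progress l → Progress (suc l)
        grow Pr with leaf? v ×-dec (level v ℕ.≟ c)
        ... | no ¬low-leaf = record
          { potentials = Potentials-restrict shrink potentials
          ; progress   = ≤-trans progress (+-monoʳ-≤ _ (sumOver-mono (partial? l) (partial? (suc l)) weight partial-grow))
          }
          where
          open Progress Pr
          shrink : Partial (suc l) ⊆ Partial l
          shrink P′w with partial-suc P′w
          ... | inj₁ Pw = Pw
          ... | inj₂ (_ , low-leaf) = contradiction low-leaf ¬low-leaf
        ... | yes (leaf , v≡c) = record { potentials = next ; progress = bound′ }
          where
          open Progress Pr
          open Potentials potentials
          v∉Partial : ¬ Partial l v
          v∉Partial (inj₁ c<v)          = 1+n≰n (subst (suc c ≤_) v≡c c<v)
          v∉Partial (inj₂ (_ , _ , v<l)) = <-irrefl v≡l v<l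
          split : Partial (suc l) ⊆ Partial l ∪ ｛ v ｝
          split P′w with partial-suc P′w
          ... | inj₁ Pw            = inj₁ Pw
          ... | inj₂ (v≡w , _)     = inj₂ v≡w
          extend : ∀ {y f′} → Candidate (potential y) f′ → Frontier (Partial (suc l)) y f′
          extend {y} cand with candidate-frontier (potential y) cand
          ... | _ , F , avail = proj₁ (Frontier-attach F v∉Partial split partial-p (attached-at-p v≡c) avail)
          admissible : ∀ {y w} → Candidate (potential y) w → Neighbour y w × 0 < dist π y w
          admissible {y} cand with candidate-frontier (potential y) cand
          ... | _ , _ , (yw , 0<yw , _) = yw , 0<yw
          advanced : Advance (Partial (suc l)) (sum λ y → count (candidate? (potential y)))
          advanced = advance-all (λ y → candidate? (potential y)) admissible extend
          open Advance advanced
          value′ : Fin n → ℕ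
          value′ = Potentials.value next
          bound′ : a D + outPos D + inPos D ≤ sum value′ + d + weightOf (partial? (suc l))
          bound′ = begin
            a D + outPos D + inPos D                                     ≤⟨ progress ⟩
            sum value + d + weightOf (partial? l)                        ≡⟨ cong (λ s → s + d + weightOf (partial? l))
                                                                              (sum-cong-≗ (count-candidate ∘ potential)) ⟨
            sum (λ y → count (candidate? (potential y))) + d
              + weightOf (partial? l)                                    ≤⟨ +-monoˡ-≤ _ (+-monoˡ-≤ d lost) ⟩
            sum value′ + d + d + weightOf (partial? l)                   ≡⟨ +-assoc (sum value′ + d) d _ ⟩
            sum value′ + d + (d + weightOf (partial? l))                 ≤⟨ +-monoʳ-≤ (sum value′ + d) (paid-by v-adjacent v-inserted) ⟩
            sum value′ + d + weightOf (partial? (suc l))                 ∎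
            where
            open ≤-Reasoning
            v-adjacent : Adjacent v p
            v-adjacent = subst (Adjacent v ∘ spineAt ∘ suc) v≡c (adjacent-leaf leaf)
            v-inserted : weightOf (partial? l) + weight v ≤ weightOf (partial? (suc l))
            v-inserted = sumOver-insert (partial? l) (partial? (suc l)) weight v
                           partial-grow (inj₂ (leaf , v≡c , ≤-reflexive (cong suc v≡l))) v∉Partial

      all-progress : ∀ l → l ≤ m → Progress l
      all-progress zero    _   = initial
      all-progress (suc l) l<m = grow (fromℕ< l<m) (toℕ-fromℕ< l<m) (all-progress l (<⇒≤ l<m))

      finish : Progress m → Stage c (π ⁻¹)
      finish Pr = record { pairs = pairs′ ; placed = placed′ ; bound = bound′ }
        where
        open Progress Pr
        open Potentials potentials
        pairs′ : Fin n → Fin n → Bool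
        pairs′ x y = does (candidate? (potential y) x)
        low∉Partial : ¬ Partial m low
        low∉Partial (inj₁ c<low)        = 1+n≰n (subst (suc c ≤_) level-low c<low)
        low∉Partial (inj₂ (leaf , _))   = spineAt-nonleaf leaf
        split : Tail c ⊆ Partial m ∪ ｛ low ｝
        split {w} c≤w with suc c ≤? level w
        ... | yes c<w = inj₁ (inj₁ c<w)
        ... | no  c≮w = at-level-c (≤-antisym (≮⇒≥ c≮w) c≤w) (spine-or-leaf w)
          where
          at-level-c : level w ≡ c → ∃[ i ] spine C i ≡ w ⊎ Leaf w → Partial m w ⊎ low ≡ w
          at-level-c w≡c (inj₂ leaf)    = inj₁ (inj₂ (leaf , w≡c , toℕ<n w))
          at-level-c w≡c (inj₁ (i , e)) = inj₂ (sym (begin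
            w                  ≡⟨ e ⟨
            spine C i          ≡⟨ spine≡spineAt i ⟩
            spineAt (toℕ i)    ≡⟨ cong spineAt (trans (sym (level-spine i)) (trans (cong level e) w≡c)) ⟩
            low                ∎))
            where open ≡-Reasoning
        placed′ : ∀ {x y} → pairs′ x y ≡ true → Placement c (π ⁻¹) x y
        placed′ {x} {y} chosen with candidate-frontier (potential y) (from-does (candidate? (potential y) x) chosen)
        ... | _ , F , avail@(yx , _) with Frontier-attach F low∉Partial split partial-p (attached-at-p level-low) avail
        ...   | F′ , map-low = record
          { map      = map
          ; map-low  = map-low
          ; map-high = map-p
          ; embeds   = embeds
          ; avoids   = λ c≤w → ¬between⇒avoids π (neighbour-irrefl yx) (clear c≤w)
          }
          where open Frontier F′
        counted : countPairs pairs′ ≡ sum value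
        counted = begin
          countPairs pairs′                                  ≡⟨ countPairs-flip (λ y x → pairs′ x y) ⟩
          countPairs (λ y x → pairs′ x y)                    ≡⟨ countPairs≡sum (λ y x → pairs′ x y) ⟩
          sum (λ y → countFin (λ x → pairs′ x y))            ≡⟨ sum-cong-≗ (λ y → countFin≡sum (λ x → pairs′ x y)) ⟩
          sum (λ y → count (candidate? (potential y)))       ≡⟨ sum-cong-≗ (λ y → count-candidate (potential y)) ⟩
          sum value                                          ∎
          where open ≡-Reasoning
        bound′ : a D + outPos D + inPos D ≤ countPairs pairs′ + weightOf (tail? c)
        bound′ = begin
          a D + outPos D + inPos D                   ≤⟨ progress ⟩
          sum value + d + weightOf (partial? m)      ≡⟨ +-assoc (sum value) d _ ⟩
          sum value + (d + weightOf (partial? m))    ≤⟨ +-mono-≤ (≤-reflexive (sym counted))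
                                                                   (paid-by (adjacent-spine (<⇒≤ c<L)) low-inserted) ⟩
          countPairs pairs′ + weightOf (tail? c)     ∎
          where
          open ≤-Reasoning
          low-inserted : weightOf (partial? m) + weight low ≤ weightOf (tail? c)
          low-inserted = sumOver-insert (partial? m) (tail? c) weight low partial-level (≤-reflexive (sym level-low)) low∉Partial

      stage-down : Stage c (π ⁻¹)
      stage-down = finish (all-progress m ≤-refl)

    stage : ∀ d {c} → c + d ≡ L → Stage c (parity d)
    stage zero    {c} c+0≡L = subst (λ c → Stage c 0ℙ) (sym (trans (sym (+-identityʳ c)) c+0≡L)) stage-top
    stage (suc d) {c} c+d≡L =
      subst (Stage c) (⁻¹-selfInverse (suc-homo-⁻¹ d)) (Step.stage-down c<L (stage d (trans (sym (+-suc c d)) c+d≡L)))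
      where
      c<L : suc c ≤ L
      c<L = subst (suc c ≤_) (trans (sym (+-suc c d)) c+d≡L) (m≤m+n (suc c) d)

    ImageOfUV : Fin n → Fin n → Fin n → Fin n → Set
    ImageOfUV s t x y = (arc T (u C) (v C) ≡ true × s ≡ x × t ≡ y) ⊎ (arc T (v C) (u C) ≡ true × s ≡ y × t ≡ x)

    good-from-placement : ∀ {x y s t} → Placement 0 (parity L) x y → ImageOfUV s t x y →
                          arc D s t ≡ true × Good D T C s t
    good-from-placement {x} {y} P image = arc-st image , embedding , at-images image , odd-side , even-side
      where
      open Placement P
      embedding : Embedding T D
      embedding = record
        { fun = map ; injective = λ _ _ → injectiveOn embeds z≤n z≤n ; arcs = λ _ _ → arcsOn embeds z≤n z≤n }
      arc-st : ∀ {s t} → ImageOfUV s t x y → arc D s t ≡ true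
      arc-st (inj₁ (uv , refl , refl)) = subst₂ (λ s t → arc D s t ≡ true) map-low map-high (arcsOn embeds z≤n z≤n uv)
      arc-st (inj₂ (vu , refl , refl)) = subst₂ (λ s t → arc D s t ≡ true) map-high map-low (arcsOn embeds z≤n z≤n vu)
      at-images : ∀ {s t} → ImageOfUV s t x y → ImageOfUV s t (map (u C)) (map (v C))
      at-images = Sum.map (λ (uv , s≡x , t≡y) → uv , trans s≡x (sym map-low) , trans t≡y (sym map-high))
                          (λ (vu , s≡y , t≡x) → vu , trans s≡y (sym map-high) , trans t≡x (sym map-low))
      avoids′ : ∀ w → Avoids (parity L) (map (u C)) (map (v C)) (map w)
      avoids′ w = subst₂ (λ x y → Avoids (parity L) x y (map w)) (sym map-low) (sym map-high) (avoids z≤n)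
      odd-side : spineSize C % 2 ≡ 1 → ∀ w → ¬ cwBetween (map (u C)) (map (v C)) (map w)
      odd-side odd w = subst (λ π → Avoids π (map (u C)) (map (v C)) (map w)) (parity-odd L odd) (avoids′ w)
      even-side : spineSize C % 2 ≡ 0 → ∀ w → ¬ cwOutside (map (u C)) (map (v C)) (map w)
      even-side even w = subst (λ π → Avoids π (map (u C)) (map (v C)) (map w)) (parity-even L even) (avoids′ w)

    oriented-good : (G : Stage 0 (parity L)) → ∀ s t → orient (arc T (u C) (v C)) (Stage.pairs G) s t ≡ true →
                    arc D s t ≡ true × Good D T C s t
    oriented-good G s t = by-orientation (arc T (u C) (v C)) refl
      where
      open Stage G
      by-orientation : ∀ b → arc T (u C) (v C) ≡ b → orient b pairs s t ≡ true → arc D s t ≡ true × Good D T C s t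
      by-orientation true  uv chosen = good-from-placement (placed chosen) (inj₁ (uv , refl , refl))
      by-orientation false uv chosen = good-from-placement (placed chosen) (inj₂ (vu , refl , refl))
        where
        vu : arc T (v C) (u C) ≡ true
        vu with adjacent-spine z≤n
        ... | inj₁ uv′ = contradiction (trans (sym uv′) uv) λ ()
        ... | inj₂ vu  = vu

open import Data.Bool using (Bool; true)
open import Data.Nat using (ℕ; _<_)
open import Data.Fin using (Fin)
open import Data.Product using (Σ; _×_)
open import Data.Integer using (ℤ; +_; _-_; _*_; _≤_)
open import Relation.Binary.PropositionalEquality using (_≡_)
open import Data.Nat using (parity; z≤n)
import Data.Nat as ℕ
open import Data.Product using (_,_)
import Data.Integer as ℤ
import Data.Integer.Properties as ℤ
open import Data.Integer.Solver using (module +-*-Solver)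
open import Relation.Binary.PropositionalEquality using (refl; sym; trans; cong; cong₂; subst₂)

open Lemmas

integer-bound : ∀ {aD oD iD oT iT k} → aD ℕ.+ oD ℕ.+ iD ℕ.≤ k ℕ.+ (iT ℕ.* oD ℕ.+ oT ℕ.* iD) →
                + aD - (+ oT - + 1) * + iD - (+ iT - + 1) * + oD ≤ + k
integer-bound {aD} {oD} {iD} {oT} {iT} {k} h = begin
  + aD - (+ oT - + 1) * + iD - (+ iT - + 1) * + oD   ≡⟨ rearrange (+ aD) (+ oD) (+ iD) (+ oT) (+ iT) ⟩
  + aD ℤ.+ + oD ℤ.+ + iD - X                          ≡⟨ cong (_- X) lhs ⟨
  + (aD ℕ.+ oD ℕ.+ iD) - X                            ≤⟨ ℤ.+-monoˡ-≤ (ℤ.- X) (ℤ.+≤+ h) ⟩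
  + (k ℕ.+ (iT ℕ.* oD ℕ.+ oT ℕ.* iD)) - X             ≡⟨ cong (_- X) rhs ⟩
  + k ℤ.+ X - X                                       ≡⟨ cancel (+ k) X ⟩
  + k                                                 ∎
  where
  open ℤ.≤-Reasoning
  open +-*-Solver
  X : ℤ
  X = + iT * + oD ℤ.+ + oT * + iD
  lhs : + (aD ℕ.+ oD ℕ.+ iD) ≡ + aD ℤ.+ + oD ℤ.+ + iD
  lhs = trans (ℤ.pos-+ (aD ℕ.+ oD) iD) (cong (ℤ._+ + iD) (ℤ.pos-+ aD oD))
  rhs : + (k ℕ.+ (iT ℕ.* oD ℕ.+ oT ℕ.* iD)) ≡ + k ℤ.+ X
  rhs = trans (ℤ.pos-+ k _)
              (cong (ℤ._+_ (+ k)) (trans (ℤ.pos-+ (iT ℕ.* oD) _) (cong₂ ℤ._+_ (ℤ.pos-* iT oD) (ℤ.pos-* oT iD))))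
  rearrange : ∀ a o i ot it → a - (ot - + 1) * i - (it - + 1) * o ≡ a ℤ.+ o ℤ.+ i - (it * o ℤ.+ ot * i)
  rearrange = solve 5 (λ a o i ot it → a :- (ot :- con (+ 1)) :* i :- (it :- con (+ 1)) :* o
                                        := a :+ o :+ i :- (it :* o :+ ot :* i)) refl
  cancel : ∀ x y → x ℤ.+ y - y ≡ x
  cancel = solve 2 (λ x y → x :+ y :- y := x) refl

lemma4p3 : (n : ℕ) → 0 < n → (D : Digraph n) →
    (m : ℕ) (T : Digraph m) (C : AntidirectedCaterpillar T) →
    Σ (Fin n → Fin n → Bool) λ S →
      (∀ s t → S s t ≡ true → arc D s t ≡ true × Good D T C s t)
      × (+ a D - (+ outPos T - + 1) * + inPos D - (+ inPos T - + 1) * + outPos D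
          ≤ + countPairs S)
lemma4p3 n _ D m T C = orient (arc T (u C) (v C)) pairs , oriented-good D C final ,
  integer-bound {a D} {outPos D} {inPos D} {outPos T} {inPos T} counted
  where
  open Caterpillar C using (L; tail?)
  final : Stage D C 0 (parity L)
  final = stage D C L refl
  open Stage final
  counted : a D ℕ.+ outPos D ℕ.+ inPos D
            ℕ.≤ countPairs (orient (arc T (u C) (v C)) pairs) ℕ.+ (inPos T ℕ.* outPos D ℕ.+ outPos T ℕ.* inPos D)
  counted = subst₂ (λ k w → a D ℕ.+ outPos D ℕ.+ inPos D ℕ.≤ k ℕ.+ w)
                   (sym (countPairs-orient (arc T (u C) (v C)) pairs)) (weightOf-full D C (tail? 0) λ _ → z≤n) bound
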